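{- For every integer $k\ge 1$ there exists an SF-extendable arrangement of $k$ line segments.
   Context: An arrangement of $k$ line segments is a set of $k$ segments in the plane whose $2k$ endpoints are distinct and in general position (no three collinear). A complete geometric graph on a finite point set $P$ in general position is the complete graph on $P$ with edges drawn as straight line segments; a subgraph is plane if no two of its edges cross. A star is a connected graph with one vertex (the center) adjacent to all other vertices and no other edges; a star-forest is a forest each of whose components is a star. An arrangement of $k$ segments is SF-extendable if the complete geometric graph on the $2k$ endpoints of the segments admits a partition of its edge set into $k+1$ plane star-forests, one of which is the perfect matching formed by the $k$ segments. -}

module Defs where

open import Data.Nat using (ℕ; suc)
open import Data.Integer using (ℤ; _-_; _*_; _<_; 0ℤ)
open import Data.Fin using (Fin; zero)
open import Data.Bool using (Bool)
open import Data.Product using (_×_; _,_; proj₁; proj₂; Σ; ∃)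
open import Data.Sum using (_⊎_)
open import Relation.Binary.PropositionalEquality using (_≡_; _≢_)
open import Relation.Nullary using (¬_)
open import Function.Bundles using (_⇔_)
open import Function.Definitions using (Injective)

-- Points of the plane with integer coordinates (for configurations
-- in general position this loses no generality for an existence statement).
Point : Set
Point = ℤ × ℤ

orient : Point → Point → Point → ℤ
orient (px , py) (qx , qy) (rx , ry) =
  ((qx - px) * (ry - py)) - ((qy - py) * (rx - px))

-- The closed segments pq and rs cross (at a point interior to both);
-- for four points in general position this is exactly "the segments intersect".
Crosses : Point → Point → Point → Point → Set
Crosses p q r s =
  (orient p q r * orient p q s < 0ℤ) × (orient r s p * orient r s q < 0ℤ)

-- Endpoints of an arrangement of k segments: segment i has endpoints (i , false), (i , true).
End : ℕ → Set
End k = Fin k × Bool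

-- u and v are the two endpoints of the same segment (used with u ≢ v).
Partner : ∀ {k} → End k → End k → Set
Partner u v = proj₁ u ≡ proj₁ v

Distinct : ∀ {k} → (End k → Point) → Set
Distinct pos = Injective _≡_ _≡_ pos

GeneralPosition : ∀ {k} → (End k → Point) → Set
GeneralPosition {k} pos =
  (u v w : End k) → u ≢ v → v ≢ w → u ≢ w → orient (pos u) (pos v) (pos w) ≢ 0ℤ

Arrangement : ∀ {k} → (End k → Point) → Set
Arrangement pos = Distinct pos × GeneralPosition pos

-- An edge colouring of the complete graph on the endpoints with colours in C:
-- the edge {u , v} (u ≢ v) gets colour col u v; the value on the diagonal is irrelevant.
Symmetric : ∀ {k} {C : Set} → (End k → End k → C) → Set
Symmetric {k} col = (u v : End k) → u ≢ v → col u v ≡ col v u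

-- Colour class i is a star-forest: the vertex set is partitioned into stars,
-- vertex v belonging to the star with centre `center v` (centres are fixed by `center`),
-- and the edges of colour i are exactly the centre–leaf pairs.
IsStarForest : ∀ {k} {C : Set} → (End k → End k → C) → C → Set
IsStarForest {k} col i =
  Σ (End k → End k) λ center →
    ((v : End k) → center (center v) ≡ center v) ×
    ((u v : End k) → u ≢ v → (col u v ≡ i ⇔ (center u ≡ v ⊎ center v ≡ u)))

-- All colour classes are plane: two edges of the same colour with four distinct
-- endpoints do not cross (edges sharing an endpoint cannot cross in general position).
IsPlaneColouring : ∀ {k} {C : Set} → (End k → Point) → (End k → End k → C) → Set
IsPlaneColouring {k} pos col =
  (a b x y : End k) → a ≢ b → a ≢ x → a ≢ y → b ≢ x → b ≢ y → x ≢ y →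
  col a b ≡ col x y → ¬ Crosses (pos a) (pos b) (pos x) (pos y)

-- SF-extendable: the edge set of the complete geometric graph on the endpoints is
-- partitioned into k+1 plane star-forests (colour classes of Fin (suc k)), one of
-- which (colour zero) is the perfect matching formed by the k segments.
SFExtendable : ∀ {k} → (End k → Point) → Set
SFExtendable {k} pos =
  Σ (End k → End k → Fin (suc k)) λ col →
    Symmetric col ×
    ((u v : End k) → u ≢ v → (col u v ≡ zero ⇔ Partner u v)) ×
    ((i : Fin (suc k)) → IsStarForest col i) ×
    IsPlaneColouring pos col

module Submission where

-- Put the endpoints on the cubic y = x³, at parameters t = ±2^r where r = 2i (lower endpoint of
-- segment i, negative) or r = 2i + 1 (upper endpoint, positive). For points with parameters p, q, r
-- on the cubic, orient = (q - p)(r - p)(r - q)(p + q + r), and since the parameters are signed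
-- distinct powers of two, the sign of a sum of three of them is the sign of the one of largest
-- magnitude. So every orientation sign is a product of explicitly known signs: no three points are
-- collinear, and non-crossing reduces to a finite sign computation. An edge between segments i < j
-- gets colour i if its endpoints are both lower or both upper, and colour j otherwise; colour m is
-- then the union of two stars centred at the endpoints of segment m.

open import Defs
open import Data.Nat using (ℕ; _≥_)
open import Data.Product using (Σ; _×_)

open import Data.Nat as ℕ using (suc)
import Data.Nat.Properties as ℕ
open import Data.Integer using (ℤ; +_; -[1+_]; _⊖_; ∣_∣; 0ℤ; _+_; _*_; _-_; -_; _<_; +<+; -<+; _◃_)
open import Data.Integer.Properties
  using ( ◃-distrib-*; ∣i+j∣≤∣i∣+∣j∣; +-monoˡ-<; +-inverseʳ; [1+m]⊖[1+n]≡m⊖n; i*j≡0⇒i≡0∨j≡0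
        ; i-j≡0⇒i≡j; *-comm; abs-cong; abs-◃; -◃n≡-n; +◃-mono-<; neg-mono-< )
open import Data.Integer.Tactic.RingSolver using (solve-∀)
open import Data.Sign as Sign using (Sign)
open import Data.Sign.Properties using (s*s≡+)
open import Data.Bool using (Bool; true; false; not; _xor_; if_then_else_)
open import Data.Bool.Properties using (xor-comm; xor-same; xor-inverseˡ; not-involutive)
open import Data.Fin as F using (Fin; zero; suc; toℕ; combine)
open import Data.Fin.Properties as FP
  using (toℕ-injective; toℕ-combine; combine-injectiveˡ; combine-injectiveʳ; combine-monoˡ-<)
open import Data.Product using (_,_; ∃; proj₁)
open import Data.Sum using (_⊎_; inj₁; inj₂; [_,_]′)
open import Data.Empty using (⊥-elim)
open import Function using (_∘_)
open import Function.Bundles using (mk⇔)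
open import Relation.Nullary using (¬_)
open import Relation.Binary.Definitions using (tri<; tri≈; tri>)
open import Relation.Binary.PropositionalEquality

-- Signs of integers

-- A data type rather than a Σ-type, so that the sign is recovered by unification.
data HasSign : Sign → ℤ → Set where
  hasSign : ∀ s n → HasSign s (s ◃ suc n)

hasSign-* : ∀ {s t x y} → HasSign s x → HasSign t y → HasSign (s Sign.* t) (x * y)
hasSign-* (hasSign s m) (hasSign t n) =
  subst (HasSign (s Sign.* t)) (◃-distrib-* s t (suc m) (suc n)) (hasSign (s Sign.* t) (n ℕ.+ m ℕ.* suc n))

hasSign⇒≢0 : ∀ {s x} → HasSign s x → x ≢ 0ℤ
hasSign⇒≢0 (hasSign Sign.- _) ()
hasSign⇒≢0 (hasSign Sign.+ _) ()

hasSign+⇒≮0 : ∀ {x} → HasSign Sign.+ x → ¬ x < 0ℤ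
hasSign+⇒≮0 (hasSign _ _) (+<+ ())

≢0⇒hasSign : ∀ {x} → x ≢ 0ℤ → ∃ λ s → HasSign s x
≢0⇒hasSign {+ ℕ.zero} x≢0 = ⊥-elim (x≢0 refl)
≢0⇒hasSign {+ suc n} _ = Sign.+ , hasSign Sign.+ n
≢0⇒hasSign { -[1+ n ]} _ = Sign.- , hasSign Sign.- n

sameSign⇒*-hasSign+ : ∀ {s x y} → HasSign s x → HasSign s y → HasSign Sign.+ (x * y)
sameSign⇒*-hasSign+ {s} h₁ h₂ = subst (λ t → HasSign t _) (s*s≡+ s) (hasSign-* h₁ h₂)

hasSign-⇒<hasSign+ : ∀ {x y} → HasSign Sign.- x → HasSign Sign.+ y → x < y
hasSign-⇒<hasSign+ (hasSign _ _) (hasSign _ _) = -<+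

>0⇒hasSign+ : ∀ {x} → 0ℤ < x → HasSign Sign.+ x
>0⇒hasSign+ {+ suc n} _ = hasSign Sign.+ n
>0⇒hasSign+ {+ ℕ.zero} (+<+ ())

<0⇒hasSign- : ∀ {x} → x < 0ℤ → HasSign Sign.- x
<0⇒hasSign- { -[1+ n ]} _ = hasSign Sign.- n
<0⇒hasSign- {+ _} (+<+ ())

<⇒hasSign+ : ∀ {x y} → x < y → HasSign Sign.+ (y - x)
<⇒hasSign+ {x} {y} x<y = >0⇒hasSign+ (subst (_< y - x) (+-inverseʳ x) (+-monoˡ-< (- x) x<y))

<⇒hasSign- : ∀ {x y} → x < y → HasSign Sign.- (x - y)
<⇒hasSign- {x} {y} x<y = <0⇒hasSign- (subst (x - y <_) (+-inverseʳ y) (+-monoˡ-< (- y) x<y))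

⊖-hasSign+ : ∀ {m n} → n ℕ.< m → HasSign Sign.+ (m ⊖ n)
⊖-hasSign+ {suc m} {ℕ.zero} _ = hasSign Sign.+ m
⊖-hasSign+ {suc m} {suc n} (ℕ.s≤s n<m) = subst (HasSign Sign.+) (sym ([1+m]⊖[1+n]≡m⊖n m n)) (⊖-hasSign+ n<m)

⊖-hasSign- : ∀ {m n} → m ℕ.< n → HasSign Sign.- (m ⊖ n)
⊖-hasSign- {ℕ.zero} {suc n} _ = hasSign Sign.- n
⊖-hasSign- {suc m} {suc n} (ℕ.s≤s m<n) = subst (HasSign Sign.-) (sym ([1+m]⊖[1+n]≡m⊖n m n)) (⊖-hasSign- m<n)

hasSign-+-dominant : ∀ {s x z} → HasSign s z → ∣ x ∣ ℕ.< ∣ z ∣ → HasSign s (x + z)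
hasSign-+-dominant {x = + m} (hasSign Sign.+ n) _ =
  subst (HasSign Sign.+) (cong +_ (sym (ℕ.+-suc m n))) (hasSign Sign.+ (m ℕ.+ n))
hasSign-+-dominant {x = -[1+ m ]} (hasSign Sign.+ n) m<n = ⊖-hasSign+ m<n
hasSign-+-dominant {x = + m} (hasSign Sign.- n) m<n = ⊖-hasSign- m<n
hasSign-+-dominant {x = -[1+ m ]} (hasSign Sign.- n) _ = hasSign Sign.- (suc (m ℕ.+ n))

hasSign-dominant : ∀ {s x y z} → HasSign s z → ∣ x ∣ ℕ.+ ∣ y ∣ ℕ.< ∣ z ∣ → HasSign s (x + y + z)
hasSign-dominant {x = x} {y} h lt = hasSign-+-dominant {x = x + y} h (ℕ.≤-<-trans (∣i+j∣≤∣i∣+∣j∣ x y) lt)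

-- Points on the cubic y = x³

*-≢0 : ∀ {x y} → x ≢ 0ℤ → y ≢ 0ℤ → x * y ≢ 0ℤ
*-≢0 {x} x≢0 y≢0 xy≡0 = [ x≢0 , y≢0 ]′ (i*j≡0⇒i≡0∨j≡0 x xy≡0)

i≢j⇒j-i≢0 : ∀ {i j} → i ≢ j → j - i ≢ 0ℤ
i≢j⇒j-i≢0 {i} {j} i≢j e = i≢j (sym (i-j≡0⇒i≡j j i e))

cubicPoint : ℤ → Point
cubicPoint x = x , x * x * x

side : ℤ → ℤ → ℤ → ℤ
side p q r = (r - p) * (r - q) * (p + q + r)

orient-cubicPoint : ∀ p q r → orient (cubicPoint p) (cubicPoint q) (cubicPoint r) ≡ (q - p) * side p q r
orient-cubicPoint p q r = cubic-identity p q r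
  where
  cubic-identity : ∀ p q r →
    (q - p) * (r * r * r - p * p * p) - (q * q * q - p * p * p) * (r - p) ≡
    (q - p) * ((r - p) * (r - q) * (p + q + r))
  cubic-identity = solve-∀

data SameSide (p q r s : ℤ) : Set where
  sameSide : ∀ {σ} → HasSign σ (side p q r) → HasSign σ (side p q s) → SameSide p q r s

orient-cubicPoint-product : ∀ p q r s →
  orient (cubicPoint p) (cubicPoint q) (cubicPoint r) * orient (cubicPoint p) (cubicPoint q) (cubicPoint s) ≡
  ((q - p) * side p q r) * ((q - p) * side p q s)
orient-cubicPoint-product p q r s = cong₂ _*_ (orient-cubicPoint p q r) (orient-cubicPoint p q s)

sameSide⇒*-hasSign+ : ∀ {p q r s} → p ≢ q → SameSide p q r s →
  HasSign Sign.+ (((q - p) * side p q r) * ((q - p) * side p q s))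
sameSide⇒*-hasSign+ p≢q (sameSide h₁ h₂) =
  let _ , h₀ = ≢0⇒hasSign (i≢j⇒j-i≢0 p≢q) in sameSign⇒*-hasSign+ (hasSign-* h₀ h₁) (hasSign-* h₀ h₂)

sameSide⇒¬straddle : ∀ {p q r s} → p ≢ q → SameSide p q r s →
  ¬ (orient (cubicPoint p) (cubicPoint q) (cubicPoint r) * orient (cubicPoint p) (cubicPoint q) (cubicPoint s) < 0ℤ)
sameSide⇒¬straddle {p} {q} {r} {s} p≢q same =
  hasSign+⇒≮0 (subst (HasSign Sign.+) (sym (orient-cubicPoint-product p q r s)) (sameSide⇒*-hasSign+ p≢q same))

orient-cubicPoint-≢0 : ∀ {p q r} → p ≢ q → p ≢ r → q ≢ r → p + q + r ≢ 0ℤ →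
  orient (cubicPoint p) (cubicPoint q) (cubicPoint r) ≢ 0ℤ
orient-cubicPoint-≢0 {p} {q} {r} p≢q p≢r q≢r sum≢0 =
  subst (_≢ 0ℤ) (sym (orient-cubicPoint p q r))
    (*-≢0 (i≢j⇒j-i≢0 p≢q) (*-≢0 (*-≢0 (i≢j⇒j-i≢0 p≢r) (i≢j⇒j-i≢0 q≢r)) sum≢0))

crosses-sym : ∀ {p q r s} → Crosses p q r s → Crosses r s p q
crosses-sym (c₁ , c₂) = c₂ , c₁

orient-swap : ∀ p q r → orient q p r ≡ - orient p q r
orient-swap (p₁ , p₂) (q₁ , q₂) (r₁ , r₂) = identity p₁ p₂ q₁ q₂ r₁ r₂
  where
  identity : ∀ p₁ p₂ q₁ q₂ r₁ r₂ →
    (p₁ - q₁) * (r₂ - q₂) - (p₂ - q₂) * (r₁ - q₁) ≡ - ((q₁ - p₁) * (r₂ - p₂) - (q₂ - p₂) * (r₁ - p₁))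
  identity = solve-∀

orient-swap-* : ∀ p q r s → orient q p r * orient q p s ≡ orient p q r * orient p q s
orient-swap-* p q r s = begin
  orient q p r * orient q p s          ≡⟨ cong₂ _*_ (orient-swap p q r) (orient-swap p q s) ⟩
  - orient p q r * - orient p q s      ≡⟨ neg-*-neg (orient p q r) (orient p q s) ⟩
  orient p q r * orient p q s          ∎
  where
  open ≡-Reasoning
  neg-*-neg : ∀ a b → - a * - b ≡ a * b
  neg-*-neg = solve-∀

crosses-swapʳ : ∀ {p q r s} → Crosses p q r s → Crosses p q s r
crosses-swapʳ {p} {q} {r} {s} (c₁ , c₂) =
  subst (_< 0ℤ) (*-comm (orient p q r) (orient p q s)) c₁ ,
  subst (_< 0ℤ) (sym (orient-swap-* r s p q)) c₂

crosses-swapˡ : ∀ {p q r s} → Crosses p q r s → Crosses q p r s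
crosses-swapˡ {p} {q} {r} {s} (c₁ , c₂) =
  subst (_< 0ℤ) (sym (orient-swap-* p q r s)) c₁ ,
  subst (_< 0ℤ) (*-comm (orient r s p) (orient r s q)) c₂

-- The arrangement

2^-mono-< : ∀ {a b} → a ℕ.< b → 2 ℕ.^ a ℕ.< 2 ℕ.^ b
2^-mono-< = ℕ.^-monoʳ-< 2 (ℕ.n<1+n 1)

2^-injective : ∀ {a b} → 2 ℕ.^ a ≡ 2 ℕ.^ b → a ≡ b
2^-injective {a} {b} e with ℕ.<-cmp a b
... | tri< a<b _ _ = ⊥-elim (ℕ.<-irrefl e (2^-mono-< a<b))
... | tri≈ _ a≡b _ = a≡b
... | tri> _ _ b<a = ⊥-elim (ℕ.<-irrefl (sym e) (2^-mono-< b<a))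

2^+2^<2^ : ∀ {a b c} → a ℕ.< b → b ℕ.< c → 2 ℕ.^ a ℕ.+ 2 ℕ.^ b ℕ.< 2 ℕ.^ c
2^+2^<2^ {a} {b} {c} a<b b<c = begin-strict
  2 ℕ.^ a ℕ.+ 2 ℕ.^ b   <⟨ ℕ.+-monoˡ-< (2 ℕ.^ b) (2^-mono-< a<b) ⟩
  2 ℕ.^ b ℕ.+ 2 ℕ.^ b   ≡⟨ cong (2 ℕ.^ b ℕ.+_) (sym (ℕ.+-identityʳ (2 ℕ.^ b))) ⟩
  2 ℕ.^ suc b           ≤⟨ ℕ.^-monoʳ-≤ 2 b<c ⟩
  2 ℕ.^ c               ∎
  where open ℕ.≤-Reasoning

distinct-2^+2^<2^ : ∀ {a b c} → a ≢ b → a ℕ.< c → b ℕ.< c → 2 ℕ.^ a ℕ.+ 2 ℕ.^ b ℕ.< 2 ℕ.^ c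
distinct-2^+2^<2^ {a} {b} {c} a≢b a<c b<c with ℕ.<-cmp a b
... | tri< a<b _ _ = 2^+2^<2^ a<b b<c
... | tri≈ _ a≡b _ = ⊥-elim (a≢b a≡b)
... | tri> _ _ b<a = subst (ℕ._< 2 ℕ.^ c) (ℕ.+-comm (2 ℕ.^ b) (2 ℕ.^ a)) (2^+2^<2^ b<a a<c)

module _ {k : ℕ} where

  lo hi : Fin k → End k
  lo i = i , false
  hi i = i , true

  bit : Bool → Fin 2
  bit false = zero
  bit true = suc zero

  bit-injective : ∀ {x y} → bit x ≡ bit y → x ≡ y
  bit-injective {false} {false} _ = refl
  bit-injective {true} {true} _ = refl

  rank : End k → ℕ
  rank (i , x) = toℕ (combine i (bit x))

  rank-injective : ∀ {u v} → rank u ≡ rank v → u ≡ v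
  rank-injective {i , x} {j , y} e =
    cong₂ _,_ (combine-injectiveˡ i (bit x) j (bit y) c) (bit-injective (combine-injectiveʳ i (bit x) j (bit y) c))
    where c = toℕ-injective e

  rank-< : ∀ {i j} x y → i F.< j → rank (i , x) ℕ.< rank (j , y)
  rank-< x y = combine-monoˡ-< (bit x) (bit y)

  rank-lo<hi : ∀ i → rank (lo i) ℕ.< rank (hi i)
  rank-lo<hi i = subst₂ ℕ._<_ (sym (toℕ-combine i zero)) (sym (toℕ-combine i (suc zero)))
    (ℕ.+-monoʳ-< (2 ℕ.* toℕ i) (ℕ.n<1+n 0))

  sgn : End k → Sign
  sgn (_ , false) = Sign.-
  sgn (_ , true) = Sign.+

  param : End k → ℤ
  param u = sgn u ◃ 2 ℕ.^ rank u

  pos : End k → Point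
  pos u = cubicPoint (param u)

  param-hasSign : ∀ u → HasSign (sgn u) (param u)
  param-hasSign u with 2 ℕ.^ rank u | ℕ.m^n>0 2 (rank u)
  ... | suc n | _ = hasSign (sgn u) n

  param-injective : ∀ {u v} → param u ≡ param v → u ≡ v
  param-injective e = rank-injective (2^-injective (abs-cong e))

  param-lo<hi : ∀ i j → param (lo i) < param (hi j)
  param-lo<hi i j = hasSign-⇒<hasSign+ (param-hasSign (lo i)) (param-hasSign (hi j))

  param-lo-antitone : ∀ {i j} → i F.< j → param (lo j) < param (lo i)
  param-lo-antitone {i} {j} i<j = subst₂ _<_ (sym (-◃n≡-n _)) (sym (-◃n≡-n _))
    (neg-mono-< (+<+ (2^-mono-< (rank-< false false i<j))))

  param-hi-monotone : ∀ {i j} → i F.< j → param (hi i) < param (hi j)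
  param-hi-monotone i<j = +◃-mono-< (2^-mono-< (rank-< true true i<j))

  param-dominant : ∀ u v w → rank u ℕ.< rank w → rank v ℕ.< rank w → u ≢ v →
    HasSign (sgn w) (param u + param v + param w)
  param-dominant u v w u<w v<w u≢v = hasSign-dominant {x = param u} {param v} (param-hasSign w) (begin-strict
    ∣ param u ∣ ℕ.+ ∣ param v ∣      ≡⟨ cong₂ ℕ._+_ (abs-◃ (sgn u) (2 ℕ.^ rank u)) (abs-◃ (sgn v) (2 ℕ.^ rank v)) ⟩
    2 ℕ.^ rank u ℕ.+ 2 ℕ.^ rank v    <⟨ distinct-2^+2^<2^ (λ e → u≢v (rank-injective e)) u<w v<w ⟩
    2 ℕ.^ rank w                     ≡⟨ abs-◃ (sgn w) (2 ℕ.^ rank w) ⟨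
    ∣ param w ∣                      ∎)
    where open ℕ.≤-Reasoning

  param-dominant-middle : ∀ u v w → rank u ℕ.< rank v → rank w ℕ.< rank v → u ≢ w →
    HasSign (sgn v) (param u + param v + param w)
  param-dominant-middle u v w u<v w<v u≢w =
    subst (HasSign (sgn v)) (+-swap (param u) (param w) (param v)) (param-dominant u w v u<v w<v u≢w)
    where
    +-swap : ∀ x y z → x + y + z ≡ x + z + y
    +-swap = solve-∀

  param-sum-≢0 : ∀ {u v w} → u ≢ v → u ≢ w → v ≢ w → param u + param v + param w ≢ 0ℤ
  param-sum-≢0 {u} {v} {w} u≢v u≢w v≢w with ℕ.<-cmp (rank u) (rank w)
  ... | tri≈ _ e _ = ⊥-elim (u≢w (rank-injective e))
  ... | tri< u<w _ _ with ℕ.<-cmp (rank v) (rank w)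
  ...   | tri< v<w _ _ = hasSign⇒≢0 (param-dominant u v w u<w v<w u≢v)
  ...   | tri≈ _ e _ = ⊥-elim (v≢w (rank-injective e))
  ...   | tri> _ _ w<v = hasSign⇒≢0 (param-dominant-middle u v w (ℕ.<-trans u<w w<v) w<v u≢w)
  param-sum-≢0 {u} {v} {w} u≢v u≢w v≢w | tri> _ _ w<u with ℕ.<-cmp (rank u) (rank v)
  ...   | tri< u<v _ _ = hasSign⇒≢0 (param-dominant-middle u v w u<v (ℕ.<-trans w<u u<v) u≢w)
  ...   | tri≈ _ e _ = ⊥-elim (u≢v (rank-injective e))
  ...   | tri> _ _ v<u = subst (_≢ 0ℤ) (rotate (param u) (param v) (param w))
                           (hasSign⇒≢0 (param-dominant v w u v<u w<u v≢w))
    where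
    rotate : ∀ x y z → y + z + x ≡ x + y + z
    rotate = solve-∀

  pos-injective : Distinct pos
  pos-injective e = param-injective (cong proj₁ e)

  pos-generalPosition : GeneralPosition pos
  pos-generalPosition u v w u≢v v≢w u≢w =
    orient-cubicPoint-≢0 (param-≢ u≢v) (param-≢ u≢w) (param-≢ v≢w) (param-sum-≢0 u≢v u≢w v≢w)
    where
    param-≢ : ∀ {u v} → u ≢ v → param u ≢ param v
    param-≢ u≢v e = u≢v (param-injective e)

  -- The colouring

  colour : End k → End k → Fin (suc k)
  colour (i , x) (j , y) with FP.<-cmp i j
  ... | tri< _ _ _ = suc (if x xor y then j else i)
  ... | tri≈ _ _ _ = zero
  ... | tri> _ _ _ = suc (if x xor y then i else j)

  colour-≡ : ∀ i x y → colour (i , x) (i , y) ≡ zero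
  colour-≡ i x y with FP.<-cmp i i
  ... | tri< i<i _ _ = ⊥-elim (FP.<-irrefl refl i<i)
  ... | tri≈ _ _ _ = refl
  ... | tri> _ _ i<i = ⊥-elim (FP.<-irrefl refl i<i)

  colour-< : ∀ {i j} x y → i F.< j → colour (i , x) (j , y) ≡ suc (if x xor y then j else i)
  colour-< {i} {j} x y i<j with FP.<-cmp i j
  ... | tri< _ _ _ = refl
  ... | tri≈ _ i≡j _ = ⊥-elim (FP.<-irrefl i≡j i<j)
  ... | tri> _ _ j<i = ⊥-elim (FP.<-asym i<j j<i)

  colour-> : ∀ {i j} x y → j F.< i → colour (i , x) (j , y) ≡ suc (if x xor y then i else j)
  colour-> {i} {j} x y j<i with FP.<-cmp i j
  ... | tri< i<j _ _ = ⊥-elim (FP.<-asym i<j j<i)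
  ... | tri≈ _ i≡j _ = ⊥-elim (FP.<-irrefl (sym i≡j) j<i)
  ... | tri> _ _ _ = refl

  colour-sym : ∀ u v → colour u v ≡ colour v u
  colour-sym (i , x) (j , y) with FP.<-cmp i j
  ... | tri< i<j _ _ = sym (trans (colour-> y x i<j) (cong (λ b → suc (if b then j else i)) (xor-comm y x)))
  ... | tri≈ _ refl _ = sym (colour-≡ i y x)
  ... | tri> _ _ j<i = sym (trans (colour-< y x j<i) (cong (λ b → suc (if b then i else j)) (xor-comm y x)))

  colour≡0⇒partner : ∀ u v → colour u v ≡ zero → Partner u v
  colour≡0⇒partner (i , x) (j , y) e with FP.<-cmp i j
  ... | tri≈ _ i≡j _ = i≡j

  partner⇒colour≡0 : ∀ u v → Partner u v → colour u v ≡ zero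
  partner⇒colour≡0 (i , x) (.i , y) refl = colour-≡ i x y

  centre : Fin k → End k → End k
  centre m (j , x) with FP.<-cmp m j
  ... | tri< _ _ _ = m , x
  ... | tri≈ _ _ _ = j , x
  ... | tri> _ _ _ = m , not x

  centre-self : ∀ m x → centre m (m , x) ≡ (m , x)
  centre-self m x with FP.<-cmp m m
  ... | tri< m<m _ _ = ⊥-elim (FP.<-irrefl refl m<m)
  ... | tri≈ _ _ _ = refl
  ... | tri> _ _ m<m = ⊥-elim (FP.<-irrefl refl m<m)

  centre-idempotent : ∀ m v → centre m (centre m v) ≡ centre m v
  centre-idempotent m (j , x) with FP.<-cmp m j
  ... | tri< _ _ _ = centre-self m x
  ... | tri≈ _ refl _ = centre-self m x
  ... | tri> _ _ _ = centre-self m (not x)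

  data Leaf (m : Fin k) : Bool → End k → Set where
    later : ∀ {j x} → m F.< j → Leaf m x (j , x)
    earlier : ∀ {j x} → j F.< m → Leaf m x (j , not x)

  data StarEdge (m : Fin k) : End k → End k → Set where
    leaf→centre : ∀ {x u} → Leaf m x u → StarEdge m u (m , x)
    centre→leaf : ∀ {x u} → Leaf m x u → StarEdge m (m , x) u

  starEdge-sym : ∀ {m u v} → StarEdge m u v → StarEdge m v u
  starEdge-sym (leaf→centre l) = centre→leaf l
  starEdge-sym (centre→leaf l) = leaf→centre l

  centre-leaf : ∀ {m x u} → Leaf m x u → centre m u ≡ (m , x)
  centre-leaf {m} (later {j} {x} m<j) with FP.<-cmp m j
  ... | tri< _ _ _ = refl
  ... | tri≈ _ m≡j _ = ⊥-elim (FP.<-irrefl m≡j m<j)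
  ... | tri> _ _ j<m = ⊥-elim (FP.<-asym m<j j<m)
  centre-leaf {m} (earlier {j} {x} j<m) with FP.<-cmp m j
  ... | tri< m<j _ _ = ⊥-elim (FP.<-asym m<j j<m)
  ... | tri≈ _ m≡j _ = ⊥-elim (FP.<-irrefl (sym m≡j) j<m)
  ... | tri> _ _ _ = cong (m ,_) (not-involutive x)

  centre⇒starEdge : ∀ m u {v} → u ≢ v → centre m u ≡ v → StarEdge m u v
  centre⇒starEdge m (j , x) u≢v e with FP.<-cmp m j
  centre⇒starEdge m (j , x) _ refl | tri< m<j _ _ = leaf→centre (later m<j)
  centre⇒starEdge m (j , x) u≢v e | tri≈ _ _ _ = ⊥-elim (u≢v e)
  centre⇒starEdge m (j , false) _ refl | tri> _ _ j<m = leaf→centre (earlier {x = true} j<m)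
  centre⇒starEdge m (j , true) _ refl | tri> _ _ j<m = leaf→centre (earlier {x = false} j<m)

  starEdge⇒centre : ∀ {m u v} → StarEdge m u v → centre m u ≡ v ⊎ centre m v ≡ u
  starEdge⇒centre (leaf→centre l) = inj₁ (centre-leaf l)
  starEdge⇒centre (centre→leaf l) = inj₂ (centre-leaf l)

  leaf-centre-colour : ∀ {m x u} → Leaf m x u → colour u (m , x) ≡ suc m
  leaf-centre-colour (later {j} {x} m<j) =
    trans (colour-> x x m<j) (cong (λ b → suc (if b then j else _)) (xor-same x))
  leaf-centre-colour (earlier {j} {x} j<m) =
    trans (colour-< (not x) x j<m) (cong (λ b → suc (if b then _ else j)) (xor-inverseˡ x))

  starEdge⇒colour : ∀ {m u v} → StarEdge m u v → colour u v ≡ suc m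
  starEdge⇒colour (leaf→centre l) = leaf-centre-colour l
  starEdge⇒colour (centre→leaf l) = trans (colour-sym _ _) (leaf-centre-colour l)

  colour-<⇒starEdge : ∀ {m i j} x y → i F.< j → suc (if x xor y then j else i) ≡ suc m →
    StarEdge m (i , x) (j , y)
  colour-<⇒starEdge false false i<j refl = centre→leaf (later i<j)
  colour-<⇒starEdge true true i<j refl = centre→leaf (later i<j)
  colour-<⇒starEdge false true i<j refl = leaf→centre (earlier i<j)
  colour-<⇒starEdge true false i<j refl = leaf→centre (earlier i<j)

  colour⇒starEdge : ∀ {m} u v → colour u v ≡ suc m → StarEdge m u v
  colour⇒starEdge (i , x) (j , y) e with FP.<-cmp i j
  ... | tri< i<j _ _ = colour-<⇒starEdge x y i<j e
  ... | tri> _ _ j<i = starEdge-sym (colour-<⇒starEdge y x j<i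
                         (trans (cong (λ b → suc (if b then i else j)) (xor-comm y x)) e))

  data SegmentEdge : End k → End k → Set where
    lo→hi : ∀ {i} → SegmentEdge (lo i) (hi i)
    hi→lo : ∀ {i} → SegmentEdge (hi i) (lo i)

  partner⇒segmentEdge : ∀ u v → u ≢ v → Partner u v → SegmentEdge u v
  partner⇒segmentEdge (i , false) (.i , true) _ refl = lo→hi
  partner⇒segmentEdge (i , true) (.i , false) _ refl = hi→lo
  partner⇒segmentEdge (i , false) (.i , false) u≢v refl = ⊥-elim (u≢v refl)
  partner⇒segmentEdge (i , true) (.i , true) u≢v refl = ⊥-elim (u≢v refl)

  colour≡0⇒segmentEdge : ∀ u v → u ≢ v → colour u v ≡ zero → SegmentEdge u v
  colour≡0⇒segmentEdge u v u≢v e = partner⇒segmentEdge u v u≢v (colour≡0⇒partner u v e)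

  segmentCentre : End k → End k
  segmentCentre u = hi (proj₁ u)

  segmentEdge⇒segmentCentre : ∀ {u v} → SegmentEdge u v → segmentCentre u ≡ v ⊎ segmentCentre v ≡ u
  segmentEdge⇒segmentCentre lo→hi = inj₁ refl
  segmentEdge⇒segmentCentre hi→lo = inj₂ refl

  colour-starForest : ∀ c → IsStarForest colour c
  colour-starForest zero = segmentCentre , (λ _ → refl) , λ u v u≢v →
    mk⇔ (λ e → segmentEdge⇒segmentCentre (colour≡0⇒segmentEdge u v u≢v e))
        [ (λ e → partner⇒colour≡0 u v (cong proj₁ e)) , (λ e → partner⇒colour≡0 u v (sym (cong proj₁ e))) ]′
  colour-starForest (suc m) = centre m , centre-idempotent m , λ u v u≢v →
    mk⇔ (λ e → starEdge⇒centre (colour⇒starEdge u v e))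
        [ (λ e → starEdge⇒colour (centre⇒starEdge m u u≢v e)) ,
          (λ e → starEdge⇒colour (starEdge-sym (centre⇒starEdge m v (u≢v ∘ sym) e))) ]′

  -- Planarity

  -- A record, so that unification never unfolds Crosses into the orientation polynomials.
  record NonCrossing (a b x y : End k) : Set where
    constructor nonCrossing
    field ¬crosses : ¬ Crosses (pos a) (pos b) (pos x) (pos y)
  open NonCrossing

  nonCrossing-sym : ∀ {a b x y} → NonCrossing x y a b → NonCrossing a b x y
  nonCrossing-sym {a} {b} {x} {y} nc = nonCrossing λ c → ¬crosses nc (crosses-sym {pos a} {pos b} {pos x} {pos y} c)

  nonCrossing-swapˡ : ∀ {a b x y} → NonCrossing b a x y → NonCrossing a b x y
  nonCrossing-swapˡ {a} {b} {x} {y} nc = nonCrossing λ c → ¬crosses nc (crosses-swapˡ {pos a} {pos b} {pos x} {pos y} c)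

  nonCrossing-swapʳ : ∀ {a b x y} → NonCrossing a b y x → NonCrossing a b x y
  nonCrossing-swapʳ {a} {b} {x} {y} nc = nonCrossing λ c → ¬crosses nc (crosses-swapʳ {pos a} {pos b} {pos x} {pos y} c)

  sameSide⇒nonCrossing : ∀ {a b x y} → a ≢ b → SameSide (param a) (param b) (param x) (param y) → NonCrossing a b x y
  sameSide⇒nonCrossing a≢b same = nonCrossing λ c → sameSide⇒¬straddle (λ e → a≢b (param-injective e)) same (proj₁ c)

  side-hasSign : ∀ {s₁ s₂ s₃} u v w → HasSign s₁ (param w - param u) → HasSign s₂ (param w - param v) →
    HasSign s₃ (param u + param v + param w) → HasSign (s₁ Sign.* s₂ Sign.* s₃) (side (param u) (param v) (param w))
  side-hasSign _ _ _ h₁ h₂ h₃ = hasSign-* (hasSign-* h₁ h₂) h₃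

  hi≢hi : ∀ {i j} → i F.< j → hi i ≢ hi j
  hi≢hi i<j e = FP.<-irrefl (cong proj₁ e) i<j

  lo≢lo : ∀ {i j} → i F.< j → lo i ≢ lo j
  lo≢lo i<j e = FP.<-irrefl (cong proj₁ e) i<j

  sameSide-segments : ∀ {i j} → i F.< j → SameSide (param (lo j)) (param (hi j)) (param (lo i)) (param (hi i))
  sameSide-segments {i} {j} i<j = sameSide
    (side-hasSign (lo j) (hi j) (lo i) (<⇒hasSign+ (param-lo-antitone i<j)) (<⇒hasSign- (param-lo<hi i j))
      (param-dominant-middle (lo j) (hi j) (lo i) (rank-lo<hi j) (rank-< false true i<j) (lo≢lo i<j ∘ sym)))
    (side-hasSign (lo j) (hi j) (hi i) (<⇒hasSign+ (param-lo<hi j i)) (<⇒hasSign- (param-hi-monotone i<j))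
      (param-dominant-middle (lo j) (hi j) (hi i) (rank-lo<hi j) (rank-< true true i<j) (λ ())))

  -- One case per kind of the two leaves (of the stars centred at lo m and at hi m): the line
  -- through one of the two edges has both endpoints of the other edge on one side.
  sameSide-later-later-hi : ∀ {m j l} → m F.< j → m F.< l → rank (lo j) ℕ.< rank (hi l) →
    SameSide (param (hi m)) (param (hi l)) (param (lo m)) (param (lo j))
  sameSide-later-later-hi {m} {j} {l} m<j m<l lo-j<hi-l = sameSide
    (side-hasSign (hi m) (hi l) (lo m) (<⇒hasSign- (param-lo<hi m m)) (<⇒hasSign- (param-lo<hi m l))
      (param-dominant-middle (hi m) (hi l) (lo m) (rank-< true true m<l) (rank-< false true m<l) (λ ())))
    (side-hasSign (hi m) (hi l) (lo j) (<⇒hasSign- (param-lo<hi j m)) (<⇒hasSign- (param-lo<hi j l))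
      (param-dominant-middle (hi m) (hi l) (lo j) (rank-< true true m<l) lo-j<hi-l (λ ())))

  sameSide-later-later-lo : ∀ {m j l} → m F.< l → l F.< j →
    SameSide (param (lo m)) (param (lo j)) (param (hi m)) (param (hi l))
  sameSide-later-later-lo {m} {j} {l} m<l l<j = sameSide
    (side-hasSign (lo m) (lo j) (hi m) (<⇒hasSign+ (param-lo<hi m m)) (<⇒hasSign+ (param-lo<hi j m))
      (param-dominant-middle (lo m) (lo j) (hi m) (rank-< false false m<j) (rank-< true false m<j) (λ ())))
    (side-hasSign (lo m) (lo j) (hi l) (<⇒hasSign+ (param-lo<hi m l)) (<⇒hasSign+ (param-lo<hi j l))
      (param-dominant-middle (lo m) (lo j) (hi l) (rank-< false false m<j) (rank-< true false l<j) (λ ())))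
    where m<j = FP.<-trans m<l l<j

  sameSide-later-earlier : ∀ {m j l} → m F.< j → l F.< m →
    SameSide (param (lo m)) (param (lo j)) (param (hi m)) (param (lo l))
  sameSide-later-earlier {m} {j} {l} m<j l<m = sameSide
    (side-hasSign (lo m) (lo j) (hi m) (<⇒hasSign+ (param-lo<hi m m)) (<⇒hasSign+ (param-lo<hi j m))
      (param-dominant-middle (lo m) (lo j) (hi m) (rank-< false false m<j) (rank-< true false m<j) (λ ())))
    (side-hasSign (lo m) (lo j) (lo l) (<⇒hasSign+ (param-lo-antitone l<m)) (<⇒hasSign+ (param-lo-antitone l<j))
      (param-dominant-middle (lo m) (lo j) (lo l) (rank-< false false m<j) (rank-< false false l<j) (lo≢lo l<m ∘ sym)))
    where l<j = FP.<-trans l<m m<j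

  sameSide-earlier-later : ∀ {m j l} → j F.< m → m F.< l →
    SameSide (param (hi m)) (param (hi l)) (param (lo m)) (param (hi j))
  sameSide-earlier-later {m} {j} {l} j<m m<l = sameSide
    (side-hasSign (hi m) (hi l) (lo m) (<⇒hasSign- (param-lo<hi m m)) (<⇒hasSign- (param-lo<hi m l))
      (param-dominant-middle (hi m) (hi l) (lo m) (rank-< true true m<l) (rank-< false true m<l) (λ ())))
    (side-hasSign (hi m) (hi l) (hi j) (<⇒hasSign- (param-hi-monotone j<m)) (<⇒hasSign- (param-hi-monotone j<l))
      (param-dominant-middle (hi m) (hi l) (hi j) (rank-< true true m<l) (rank-< true true j<l) (hi≢hi j<m ∘ sym)))
    where j<l = FP.<-trans j<m m<l

  sameSide-earlier-earlier : ∀ {m j l} → j F.< m → l F.< m →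
    SameSide (param (hi j)) (param (lo m)) (param (hi m)) (param (lo l))
  sameSide-earlier-earlier {m} {j} {l} j<m l<m = sameSide
    (side-hasSign (hi j) (lo m) (hi m) (<⇒hasSign+ (param-hi-monotone j<m)) (<⇒hasSign+ (param-lo<hi m m))
      (param-dominant (hi j) (lo m) (hi m) (rank-< true true j<m) (rank-lo<hi m) (λ ())))
    (side-hasSign (hi j) (lo m) (lo l) (<⇒hasSign- (param-lo<hi l j)) (<⇒hasSign+ (param-lo-antitone l<m))
      (param-dominant-middle (hi j) (lo m) (lo l) (rank-< true false j<m) (rank-< false false l<m) (λ ())))

  leaves-nonCrossing : ∀ {m u w} → Leaf m false u → Leaf m true w → NonCrossing (lo m) u (hi m) w
  leaves-nonCrossing (later {j} m<j) (later {l} m<l) with FP.<-cmp j l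
  ... | tri< j<l _ _ = nonCrossing-sym (sameSide⇒nonCrossing (hi≢hi m<l) (sameSide-later-later-hi m<j m<l (rank-< false true j<l)))
  ... | tri≈ _ refl _ = nonCrossing-sym (sameSide⇒nonCrossing (hi≢hi m<l) (sameSide-later-later-hi m<j m<l (rank-lo<hi j)))
  ... | tri> _ _ l<j = sameSide⇒nonCrossing (lo≢lo m<j) (sameSide-later-later-lo m<l l<j)
  leaves-nonCrossing (later m<j) (earlier l<m) = sameSide⇒nonCrossing (lo≢lo m<j) (sameSide-later-earlier m<j l<m)
  leaves-nonCrossing (earlier j<m) (later m<l) =
    nonCrossing-sym (sameSide⇒nonCrossing (hi≢hi m<l) (sameSide-earlier-later j<m m<l))
  leaves-nonCrossing (earlier j<m) (earlier l<m) =
    nonCrossing-swapˡ (sameSide⇒nonCrossing (λ ()) (sameSide-earlier-earlier j<m l<m))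

  centre-leaves-nonCrossing : ∀ {m x y u w} → x ≢ y → Leaf m x u → Leaf m y w → NonCrossing (m , x) u (m , y) w
  centre-leaves-nonCrossing {x = false} {false} x≢y _ _ = ⊥-elim (x≢y refl)
  centre-leaves-nonCrossing {x = false} {true} _ l₁ l₂ = leaves-nonCrossing l₁ l₂
  centre-leaves-nonCrossing {x = true} {false} _ l₁ l₂ = nonCrossing-sym (leaves-nonCrossing l₂ l₁)
  centre-leaves-nonCrossing {x = true} {true} x≢y _ _ = ⊥-elim (x≢y refl)

  starEdges-nonCrossing : ∀ {m a b c d} → StarEdge m a b → StarEdge m c d →
    a ≢ c → a ≢ d → b ≢ c → b ≢ d → NonCrossing a b c d
  starEdges-nonCrossing (leaf→centre l₁) (leaf→centre l₂) _ _ _ b≢d =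
    nonCrossing-swapˡ (nonCrossing-swapʳ (centre-leaves-nonCrossing (b≢d ∘ cong (_ ,_)) l₁ l₂))
  starEdges-nonCrossing (leaf→centre l₁) (centre→leaf l₂) _ _ b≢c _ =
    nonCrossing-swapˡ (centre-leaves-nonCrossing (b≢c ∘ cong (_ ,_)) l₁ l₂)
  starEdges-nonCrossing (centre→leaf l₁) (leaf→centre l₂) _ a≢d _ _ =
    nonCrossing-swapʳ (centre-leaves-nonCrossing (a≢d ∘ cong (_ ,_)) l₁ l₂)
  starEdges-nonCrossing (centre→leaf l₁) (centre→leaf l₂) a≢c _ _ _ =
    centre-leaves-nonCrossing (a≢c ∘ cong (_ ,_)) l₁ l₂

  segments-nonCrossing : ∀ {i j} → i ≢ j → NonCrossing (lo i) (hi i) (lo j) (hi j)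
  segments-nonCrossing {i} {j} i≢j with FP.<-cmp i j
  ... | tri< i<j _ _ = nonCrossing-sym (sameSide⇒nonCrossing (λ ()) (sameSide-segments i<j))
  ... | tri≈ _ i≡j _ = ⊥-elim (i≢j i≡j)
  ... | tri> _ _ j<i = sameSide⇒nonCrossing (λ ()) (sameSide-segments j<i)

  segmentEdges-nonCrossing : ∀ {a b c d} → SegmentEdge a b → SegmentEdge c d → a ≢ c → a ≢ d → NonCrossing a b c d
  segmentEdges-nonCrossing lo→hi lo→hi a≢c _ = segments-nonCrossing (a≢c ∘ cong lo)
  segmentEdges-nonCrossing lo→hi hi→lo _ a≢d = nonCrossing-swapʳ (segments-nonCrossing (a≢d ∘ cong lo))
  segmentEdges-nonCrossing hi→lo lo→hi _ a≢d = nonCrossing-swapˡ (segments-nonCrossing (a≢d ∘ cong hi))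
  segmentEdges-nonCrossing hi→lo hi→lo a≢c _ =
    nonCrossing-swapˡ (nonCrossing-swapʳ (segments-nonCrossing (a≢c ∘ cong hi)))

  colour-plane : IsPlaneColouring pos colour
  colour-plane a b c d a≢b a≢c a≢d b≢c b≢d c≢d same with colour a b in e
  ... | zero = ¬crosses (segmentEdges-nonCrossing (colour≡0⇒segmentEdge a b a≢b e)
                          (colour≡0⇒segmentEdge c d c≢d (sym same)) a≢c a≢d)
  ... | suc m = ¬crosses (starEdges-nonCrossing (colour⇒starEdge a b e) (colour⇒starEdge c d (sym same)) a≢c a≢d b≢c b≢d)

theorem3 : (k : ℕ) → k ≥ 1 →
    Σ (End k → Point) λ pos → Arrangement pos × SFExtendable pos
theorem3 k _ = pos , (pos-injective , pos-generalPosition) ,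
  colour , (λ u v _ → colour-sym u v) , (λ u v _ → mk⇔ (colour≡0⇒partner u v) (partner⇒colour≡0 u v)) ,
  colour-starForest , colour-plane
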